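{- Let $l\ge0$ be an integer. If an $(l+2)$-UM-critical tree has exactly one vertex $v$ of degree at least $3$, then it contains a path with $2^l$ vertices that ends in $v$.
   Context: For a graph $G$, a unique-maximum coloring w.r.t. paths is a function $C\colon V(G)\to\{1,\dots,c\}$ such that for the vertex set of every path of $G$ (including single vertices) the maximum color on it occurs exactly once; $\mathrm{UM}(G)$ is the minimum such $c$. A graph is UM-critical if every proper subgraph has smaller UM; it is $k$-UM-critical if moreover its UM equals $k$. -}

module Defs where

open import Data.Nat using (ℕ; _≤_; _<_)
open import Data.Fin using (Fin)
open import Data.Bool using (Bool; true; false)
open import Data.List using (List; []; _∷_; _++_; [_]; length; filterᵇ; allFin; head; last)
open import Data.List.Membership.Propositional using (_∈_)
open import Data.List.Relation.Unary.All using (All)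
open import Data.List.Relation.Unary.Linked using (Linked)
open import Data.List.Relation.Unary.Unique.Propositional using (Unique)
open import Data.Maybe using (just)
open import Data.Product using (Σ; _×_; ∃; ∃-syntax)
open import Data.Sum using (_⊎_)
open import Relation.Binary.PropositionalEquality using (_≡_; _≢_)
open import Relation.Nullary using (¬_)

-- A finite simple graph whose vertices are a subset V of Fin n and whose
-- edges are given by a symmetric irreflexive Boolean relation E between
-- vertices of V.  (Using a vertex mask lets subgraphs live on the same Fin n.)
record Graph (n : ℕ) : Set where
  field
    V     : Fin n → Bool
    E     : Fin n → Fin n → Bool
    E-sym : ∀ u v → E u v ≡ E v u
    E-irr : ∀ v → E v v ≡ false
    E-V   : ∀ u v → E u v ≡ true → V u ≡ true
open Graph public

module _ {n : ℕ} (G : Graph n) where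

  IsPath : List (Fin n) → Set
  IsPath P = (P ≢ []) × All (λ v → V G v ≡ true) P × Unique P
             × Linked (λ u v → E G u v ≡ true) P

  deg : Fin n → ℕ
  deg v = length (filterᵇ (E G v) (allFin n))

  UniqueMax : (Fin n → ℕ) → List (Fin n) → Set
  UniqueMax C P = ∃[ x ] (x ∈ P × (∀ y → y ∈ P → y ≢ x → C y < C x))

  UMColoring : ℕ → (Fin n → ℕ) → Set
  UMColoring c C = (∀ v → V G v ≡ true → (1 ≤ C v) × (C v ≤ c))
                 × (∀ P → IsPath P → UniqueMax C P)

  HasUMColoring : ℕ → Set
  HasUMColoring c = Σ (Fin n → ℕ) (UMColoring c)

  IsUM : ℕ → Set
  IsUM k = HasUMColoring k × (∀ c → c < k → ¬ HasUMColoring c)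

  Full : Set
  Full = ∀ v → V G v ≡ true

  Connected : Set
  Connected = ∀ u v → ∃[ P ] (IsPath P × head P ≡ just u × last P ≡ just v)

  Acyclic : Set
  Acyclic = ∀ u xs w → IsPath (u ∷ xs ++ [ w ]) → 1 ≤ length xs → E G w u ≡ false

  IsTree : Set
  IsTree = Full × Connected × Acyclic

Subgraph : {n : ℕ} → Graph n → Graph n → Set
Subgraph {n} H G = (∀ v → V H v ≡ true → V G v ≡ true)
                 × (∀ u v → E H u v ≡ true → E G u v ≡ true)

ProperSubgraph : {n : ℕ} → Graph n → Graph n → Set
ProperSubgraph {n} H G = Subgraph H G
  × ((∃[ v ] (V G v ≡ true × V H v ≡ false))
     ⊎ (∃[ u ] ∃[ v ] (E G u v ≡ true × E H u v ≡ false)))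

UMCritical : {n : ℕ} → Graph n → Set
UMCritical {n} G = ∀ (H : Graph n) → ProperSubgraph H G →
  ∀ k k′ → IsUM G k → IsUM H k′ → k′ < k

UMCriticalOf : {n : ℕ} → ℕ → Graph n → Set
UMCriticalOf k G = IsUM G k × UMCritical G

-- All vertices other than v have degree at most 2, so the tree is a spider: paths (legs) glued
-- at v. A path avoiding v therefore runs monotonically along one leg, and the distances to v of
-- its vertices form an interval of consecutive positive integers. If every vertex lies at
-- distance below 2^l from v, colour v with l + 1 and every other vertex u with one plus the
-- 2-adic valuation of dist u: on an interval of positive integers below 2^l that valuation has
-- a unique maximum, and v is the unique maximum of every path through it. This UM-colouring with
-- l + 1 colours contradicts UM = l + 2, so some vertex lies at distance at least 2^l − 1 from v,
-- and the last 2^l vertices of its path to v form the required path.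

module Submission where

open import Defs
open import Data.Bool using (Bool; true; false) renaming (_≟_ to _≟ᵇ_)
open import Data.Empty using (⊥; ⊥-elim)
open import Data.Fin using (Fin) renaming (_≟_ to _≟ᶠ_)
open import Data.Fin.Properties using (any?)
open import Data.List using (List; []; _∷_; [_]; _++_; length; last; filterᵇ; allFin)
open import Data.List.Properties using (++-assoc; ∷-injectiveˡ)
open import Data.List.Membership.Propositional using (_∈_)
open import Data.List.Membership.Propositional.Properties using (∈-∃++; ∈-++⁺ʳ; ∈-allFin)
open import Data.List.Relation.Unary.Any using (here; there)
open import Data.List.Relation.Unary.All as All using (All; []; _∷_)
open import Data.List.Relation.Unary.All.Properties using (++⁺; ++⁻ˡ)
open import Data.List.Relation.Unary.AllPairs using ([]; _∷_)
open import Data.List.Relation.Unary.Linked using (Linked; []; [-]; _∷_)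
open import Data.List.Relation.Unary.Unique.Propositional using (Unique)
import Data.List.Relation.Unary.Unique.Propositional.Properties as Unique
open import Data.Maybe using (just)
open import Data.Maybe.Properties using (just-injective)
open import Data.Nat
open import Data.Nat.Properties
open import Data.Product using (∃-syntax; _×_; _,_; proj₁; proj₂)
open import Data.Sum using (_⊎_; inj₁; inj₂; [_,_]′)
open import Relation.Binary using (DecidableEquality; tri<; tri≈; tri>)
open import Relation.Binary.PropositionalEquality hiding ([_])
open import Relation.Nullary using (yes; no; ¬_; _⊎-dec_; _×-dec_)
open import Relation.Unary using (Decidable)

UniqueMaxOn : (ℕ → ℕ) → ℕ → ℕ → Set
UniqueMaxOn g a b =
  ∃[ m ] (a ≤ m × m ≤ b × (∀ k → a ≤ k → k ≤ b → k ≢ m → g k < g m))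

uniqueMaxOn-cong : ∀ {g g′ a b} → (∀ k → a ≤ k → k ≤ b → g k ≡ g′ k) →
                   UniqueMaxOn g a b → UniqueMaxOn g′ a b
uniqueMaxOn-cong g≗g′ (m , a≤m , m≤b , max) =
  m , a≤m , m≤b , λ k a≤k k≤b k≢m →
    subst₂ _<_ (g≗g′ k a≤k k≤b) (g≗g′ m a≤m m≤b) (max k a≤k k≤b k≢m)

uniqueMaxOn-shift : ∀ {g a b} h → UniqueMaxOn g a b →
                    UniqueMaxOn (λ k → g (k ∸ h)) (h + a) (h + b)
uniqueMaxOn-shift {g} {a} h (m , a≤m , m≤b , max) =
  h + m , +-monoʳ-≤ h a≤m , +-monoʳ-≤ h m≤b , λ k h+a≤k k≤h+b k≢h+m →
    let h≤k = ≤-trans (m≤m+n h a) h+a≤k in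
    subst (λ t → g (k ∸ h) < g t) (sym (m+n∸m≡n h m))
      (max (k ∸ h) (m+n≤o⇒m≤o∸n a (subst (_≤ k) (+-comm h a) h+a≤k))
           (m≤n+o⇒m∸n≤o k h k≤h+b)
           (λ k∸h≡m → k≢h+m (trans (sym (m+[n∸m]≡n h≤k)) (cong (h +_) k∸h≡m))))

∸-<-half : ∀ {h d} → h ≤ d → d < 2 * h → d ∸ h < h
∸-<-half {h} {d} h≤d d<2h =
  subst (d ∸ h <_) (trans (m+n∸m≡n h (h + 0)) (+-identityʳ h)) (∸-monoˡ-< d<2h h≤d)

-- For 0 < d < 2 ^ l, ruler l d is one plus the 2-adic valuation of d.
ruler : ℕ → ℕ → ℕ
ruler zero    d = 0
ruler (suc l) d with <-cmp d (2 ^ l)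
... | tri< _ _ _ = ruler l d
... | tri≈ _ _ _ = suc l
... | tri> _ _ _ = ruler l (d ∸ 2 ^ l)

ruler-low : ∀ l {d} → d < 2 ^ l → ruler (suc l) d ≡ ruler l d
ruler-low l {d} d<h with <-cmp d (2 ^ l)
... | tri< _ _ _   = refl
... | tri≈ _ d≡h _ = ⊥-elim (<⇒≢ d<h d≡h)
... | tri> _ _ h<d = ⊥-elim (<-asym d<h h<d)

ruler-high : ∀ l {d} → 2 ^ l < d → ruler (suc l) d ≡ ruler l (d ∸ 2 ^ l)
ruler-high l {d} h<d with <-cmp d (2 ^ l)
... | tri< d<h _ _ = ⊥-elim (<-asym d<h h<d)
... | tri≈ _ d≡h _ = ⊥-elim (>⇒≢ h<d d≡h)
... | tri> _ _ _   = refl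

ruler-top : ∀ l → ruler (suc l) (2 ^ l) ≡ suc l
ruler-top l with <-cmp (2 ^ l) (2 ^ l)
... | tri< h<h _ _ = ⊥-elim (<-irrefl refl h<h)
... | tri≈ _ _ _   = refl
... | tri> _ _ h<h = ⊥-elim (<-irrefl refl h<h)

ruler-≤ : ∀ l d → ruler l d ≤ l
ruler-≤ zero    d = z≤n
ruler-≤ (suc l) d with <-cmp d (2 ^ l)
... | tri< _ _ _ = m≤n⇒m≤1+n (ruler-≤ l d)
... | tri≈ _ _ _ = ≤-refl
... | tri> _ _ _ = m≤n⇒m≤1+n (ruler-≤ l (d ∸ 2 ^ l))

ruler-<-top : ∀ l {d} → d ≢ 2 ^ l → ruler (suc l) d < suc l
ruler-<-top l {d} d≢h with <-cmp d (2 ^ l)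
... | tri< _ _ _   = s≤s (ruler-≤ l d)
... | tri≈ _ d≡h _ = ⊥-elim (d≢h d≡h)
... | tri> _ _ _   = s≤s (ruler-≤ l (d ∸ 2 ^ l))

ruler-positive : ∀ l {d} → 0 < d → d < 2 ^ l → 0 < ruler l d
ruler-positive zero    {d} 0<d (s≤s d≤0) = ⊥-elim (<⇒≱ 0<d d≤0)
ruler-positive (suc l) {d} 0<d d<2h with <-cmp d (2 ^ l)
... | tri< d<h _ _ = ruler-positive l 0<d d<h
... | tri≈ _ _ _   = z<s
... | tri> _ _ h<d = ruler-positive l (m<n⇒0<n∸m h<d) (∸-<-half (<⇒≤ h<d) d<2h)

ruler-uniqueMaxOn : ∀ l {a b} → 0 < a → a ≤ b → b < 2 ^ l → UniqueMaxOn (ruler l) a b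
ruler-uniqueMaxOn zero    0<a a≤b (s≤s b≤0) = ⊥-elim (<⇒≱ 0<a (≤-trans a≤b b≤0))
ruler-uniqueMaxOn (suc l) {a} {b} 0<a a≤b b<2h with b <? 2 ^ l | 2 ^ l <? a
... | yes b<h | _ =
  uniqueMaxOn-cong (λ k _ k≤b → sym (ruler-low l (≤-<-trans k≤b b<h)))
    (ruler-uniqueMaxOn l 0<a a≤b b<h)
... | no _ | yes h<a =
  uniqueMaxOn-cong (λ k a≤k _ → sym (ruler-high l (<-≤-trans h<a a≤k)))
    (subst₂ (UniqueMaxOn _) (m+[n∸m]≡n h≤a) (m+[n∸m]≡n h≤b)
      (uniqueMaxOn-shift h
        (ruler-uniqueMaxOn l (m<n⇒0<n∸m h<a) (∸-monoˡ-≤ h a≤b) (∸-<-half h≤b b<2h))))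
  where
  h = 2 ^ l
  h≤a = <⇒≤ h<a
  h≤b = ≤-trans h≤a a≤b
... | no b≮h | no h≮a =
  2 ^ l , ≮⇒≥ h≮a , ≮⇒≥ b≮h , λ k _ _ k≢h →
    subst (ruler (suc l) k <_) (sym (ruler-top l)) (ruler-<-top l k≢h)

module _ {A : Set} (h : A → ℕ) where

  record Spans (P : List A) (a b : ℕ) : Set where
    field
      a≤b       : a ≤ b
      bounded   : ∀ {y} → y ∈ P → a ≤ h y × h y ≤ b
      onto      : ∀ {k} → a ≤ k → k ≤ b → ∃[ y ] (y ∈ P × h y ≡ k)
      injective : ∀ {y z} → y ∈ P → z ∈ P → h y ≡ h z → y ≡ z
  open Spans

  spans-uniqueMax : ∀ {P a b} (g : ℕ → ℕ) (C : A → ℕ) → Spans P a b → UniqueMaxOn g a b →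
                    (∀ {y} → y ∈ P → C y ≡ g (h y)) →
                    ∃[ x ] (x ∈ P × (∀ y → y ∈ P → y ≢ x → C y < C x))
  spans-uniqueMax g C S (m , a≤m , m≤b , max) C≗g∘h =
    let (x , x∈P , hx≡m) = onto S a≤m m≤b in
    x , x∈P , λ y y∈P y≢x →
      let (a≤hy , hy≤b) = bounded S y∈P in
      subst₂ _<_ (sym (C≗g∘h y∈P)) (sym (trans (C≗g∘h x∈P) (cong g hx≡m)))
        (max (h y) a≤hy hy≤b (λ hy≡m → y≢x (injective S y∈P x∈P (trans hy≡m (sym hx≡m)))))

  spans-[_] : ∀ x → Spans [ x ] (h x) (h x)
  spans-[ x ] = record
    { a≤b       = ≤-refl
    ; bounded   = λ { (here refl) → ≤-refl , ≤-refl }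
    ; onto      = λ hx≤k k≤hx → x , here refl , ≤-antisym hx≤k k≤hx
    ; injective = λ { (here refl) (here refl) _ → refl }
    }

  spans-∷-below : ∀ {x P b} → Spans P (suc (h x)) b → Spans (x ∷ P) (h x) b
  spans-∷-below {x} {P} {b} S = record
    { a≤b       = <⇒≤ (a≤b S)
    ; bounded   = λ { (here refl) → ≤-refl , <⇒≤ (a≤b S)
                    ; (there y∈P) → <⇒≤ (proj₁ (bounded S y∈P)) , proj₂ (bounded S y∈P) }
    ; onto      = onto′
    ; injective = injective′
    }
    where
    onto′ : ∀ {k} → h x ≤ k → k ≤ b → ∃[ y ] (y ∈ x ∷ P × h y ≡ k)
    onto′ {k} hx≤k k≤b with h x ≟ k
    ... | yes hx≡k = x , here refl , hx≡k
    ... | no hx≢k  = let (y , y∈P , hy≡k) = onto S (≤∧≢⇒< hx≤k hx≢k) k≤b in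
                     y , there y∈P , hy≡k
    injective′ : ∀ {y z} → y ∈ x ∷ P → z ∈ x ∷ P → h y ≡ h z → y ≡ z
    injective′ (here refl) (here refl) _     = refl
    injective′ (here refl) (there z∈P) hx≡hz = ⊥-elim (<⇒≢ (proj₁ (bounded S z∈P)) hx≡hz)
    injective′ (there y∈P) (here refl) hy≡hx = ⊥-elim (<⇒≢ (proj₁ (bounded S y∈P)) (sym hy≡hx))
    injective′ (there y∈P) (there z∈P) hy≡hz = injective S y∈P z∈P hy≡hz

  spans-∷-above : ∀ {x P a b} → Spans P a b → h x ≡ suc b → Spans (x ∷ P) a (h x)
  spans-∷-above {x} {P} {a} {b} S hx≡1+b = record
    { a≤b       = ≤-trans (a≤b S) b≤hx
    ; bounded   = λ { (here refl) → ≤-trans (a≤b S) b≤hx , ≤-refl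
                    ; (there y∈P) → proj₁ (bounded S y∈P) , ≤-trans (proj₂ (bounded S y∈P)) b≤hx }
    ; onto      = onto′
    ; injective = injective′
    }
    where
    b≤hx : b ≤ h x
    b≤hx = subst (b ≤_) (sym hx≡1+b) (n≤1+n b)
    hy<hx : ∀ {y} → y ∈ P → h y < h x
    hy<hx y∈P = subst (h _ <_) (sym hx≡1+b) (s≤s (proj₂ (bounded S y∈P)))
    onto′ : ∀ {k} → a ≤ k → k ≤ h x → ∃[ y ] (y ∈ x ∷ P × h y ≡ k)
    onto′ {k} a≤k k≤hx with k ≟ h x
    ... | yes k≡hx = x , here refl , sym k≡hx
    ... | no k≢hx  =
      let (y , y∈P , hy≡k) = onto S a≤k (s≤s⁻¹ (subst (suc k ≤_) hx≡1+b (≤∧≢⇒< k≤hx k≢hx))) in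
      y , there y∈P , hy≡k
    injective′ : ∀ {y z} → y ∈ x ∷ P → z ∈ x ∷ P → h y ≡ h z → y ≡ z
    injective′ (here refl) (here refl) _     = refl
    injective′ (here refl) (there z∈P) hx≡hz = ⊥-elim (<⇒≢ (hy<hx z∈P) (sym hx≡hz))
    injective′ (there y∈P) (here refl) hy≡hx = ⊥-elim (<⇒≢ (hy<hx y∈P) hy≡hx)
    injective′ (there y∈P) (there z∈P) hy≡hz = injective S y∈P z∈P hy≡hz

  Ascending Descending : List A → Set
  Ascending  = Linked (λ y z → h z ≡ suc (h y))
  Descending = Linked (λ y z → h y ≡ suc (h z))

  ascending-spans : ∀ x r → Ascending (x ∷ r) → ∃[ b ] Spans (x ∷ r) (h x) b
  ascending-spans x []      _                = h x , spans-[ x ]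
  ascending-spans x (y ∷ r) (hy≡1+hx ∷ asc) =
    let (b , S) = ascending-spans y r asc in
    b , spans-∷-below (subst (λ t → Spans (y ∷ r) t b) hy≡1+hx S)

  descending-spans : ∀ x r → Descending (x ∷ r) → ∃[ a ] Spans (x ∷ r) a (h x)
  descending-spans x []      _                = h x , spans-[ x ]
  descending-spans x (y ∷ r) (hx≡1+hy ∷ desc) =
    let (a , S) = descending-spans y r desc in
    a , spans-∷-above S hx≡1+hy

module _ {A : Set} where

  Unique-++⁻ˡ : ∀ xs {ys} → Unique {A = A} (xs ++ ys) → Unique xs
  Unique-++⁻ˡ []       _              = []
  Unique-++⁻ˡ (x ∷ xs) (x∉xs++ys ∷ u) = ++⁻ˡ xs x∉xs++ys ∷ Unique-++⁻ˡ xs u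

  Linked-++⁻ˡ : ∀ {R : A → A → Set} xs {ys} → Linked R (xs ++ ys) → Linked R xs
  Linked-++⁻ˡ []           _        = []
  Linked-++⁻ˡ (x ∷ [])     _        = [-]
  Linked-++⁻ˡ (x ∷ y ∷ xs) (r ∷ rs) = r ∷ Linked-++⁻ˡ (y ∷ xs) rs

  Unique-∷ʳ : ∀ {xs} {y : A} → Unique xs → ¬ y ∈ xs → Unique (xs ++ [ y ])
  Unique-∷ʳ u y∉xs = Unique.++⁺ u ([] ∷ []) λ { (y∈xs , here refl) → y∉xs y∈xs }

  Linked-∷ʳ : ∀ {R : A → A → Set} xs {y z} → Linked R (xs ++ [ y ]) → R y z →
              Linked R ((xs ++ [ y ]) ++ [ z ])
  Linked-∷ʳ []           _          r = r ∷ [-]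
  Linked-∷ʳ (x ∷ [])     (r′ ∷ [-]) r = r′ ∷ r ∷ [-]
  Linked-∷ʳ (x ∷ w ∷ xs) (r′ ∷ rs)  r = r′ ∷ Linked-∷ʳ (w ∷ xs) rs r

module _ {A : Set} (g : A → Bool) where

  filterᵇ-accept : ∀ {x} xs → g x ≡ true → filterᵇ g (x ∷ xs) ≡ x ∷ filterᵇ g xs
  filterᵇ-accept xs gx rewrite gx = refl

  length-filterᵇ-∷ : ∀ x xs → length (filterᵇ g xs) ≤ length (filterᵇ g (x ∷ xs))
  length-filterᵇ-∷ x xs with g x
  ... | true  = n≤1+n _
  ... | false = ≤-refl

  length-filterᵇ-≥1 : ∀ {x} xs → x ∈ xs → g x ≡ true → 1 ≤ length (filterᵇ g xs)
  length-filterᵇ-≥1 (y ∷ xs) (here refl) gx rewrite filterᵇ-accept xs gx = s≤s z≤n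
  length-filterᵇ-≥1 (y ∷ xs) (there x∈) gx =
    ≤-trans (length-filterᵇ-≥1 xs x∈ gx) (length-filterᵇ-∷ y xs)

  length-filterᵇ-≥2 : ∀ {x z} xs → x ≢ z → x ∈ xs → z ∈ xs → g x ≡ true → g z ≡ true →
                      2 ≤ length (filterᵇ g xs)
  length-filterᵇ-≥2 (y ∷ xs) x≢z (here refl) (here refl) _  _ = ⊥-elim (x≢z refl)
  length-filterᵇ-≥2 (y ∷ xs) x≢z (here refl) (there z∈)  gx gz
    rewrite filterᵇ-accept xs gx = s≤s (length-filterᵇ-≥1 xs z∈ gz)
  length-filterᵇ-≥2 (y ∷ xs) x≢z (there x∈)  (here refl) gx gz
    rewrite filterᵇ-accept xs gz = s≤s (length-filterᵇ-≥1 xs x∈ gx)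
  length-filterᵇ-≥2 (y ∷ xs) x≢z (there x∈)  (there z∈)  gx gz =
    ≤-trans (length-filterᵇ-≥2 xs x≢z x∈ z∈ gx gz) (length-filterᵇ-∷ y xs)

  length-filterᵇ-≥3 : ∀ {x y z} xs → x ≢ y → x ≢ z → y ≢ z → x ∈ xs → y ∈ xs → z ∈ xs →
                      g x ≡ true → g y ≡ true → g z ≡ true → 3 ≤ length (filterᵇ g xs)
  length-filterᵇ-≥3 (w ∷ xs) x≢y _ _ (here refl) (here refl) _ _ _ _ = ⊥-elim (x≢y refl)
  length-filterᵇ-≥3 (w ∷ xs) _ x≢z _ (here refl) _ (here refl) _ _ _ = ⊥-elim (x≢z refl)
  length-filterᵇ-≥3 (w ∷ xs) _ _ y≢z _ (here refl) (here refl) _ _ _ = ⊥-elim (y≢z refl)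
  length-filterᵇ-≥3 (w ∷ xs) _ _ y≢z (here refl) (there y∈) (there z∈) gx gy gz
    rewrite filterᵇ-accept xs gx = s≤s (length-filterᵇ-≥2 xs y≢z y∈ z∈ gy gz)
  length-filterᵇ-≥3 (w ∷ xs) _ x≢z _ (there x∈) (here refl) (there z∈) gx gy gz
    rewrite filterᵇ-accept xs gy = s≤s (length-filterᵇ-≥2 xs x≢z x∈ z∈ gx gz)
  length-filterᵇ-≥3 (w ∷ xs) x≢y _ _ (there x∈) (there y∈) (here refl) gx gy gz
    rewrite filterᵇ-accept xs gz = s≤s (length-filterᵇ-≥2 xs x≢y x∈ y∈ gx gy)
  length-filterᵇ-≥3 (w ∷ xs) x≢y x≢z y≢z (there x∈) (there y∈) (there z∈) gx gy gz =
    ≤-trans (length-filterᵇ-≥3 xs x≢y x≢z y≢z x∈ y∈ z∈ gx gy gz) (length-filterᵇ-∷ w xs)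

module _ {A : Set} (_≟ᴬ_ : DecidableEquality A) {R : A → A → Set}
         (R-sym : ∀ {x y} → R x y → R y x) where

  open import Data.List.Membership.DecPropositional _≟ᴬ_ using (_∈?_)

  record Route (b a : A) (S : A → Set) : Set where
    field
      body      : List A
      starts-at : ∃[ t ] (body ++ [ a ] ≡ b ∷ t)
      unique    : Unique (body ++ [ a ])
      linked    : Linked R (body ++ [ a ])
      within    : All S (body ++ [ a ])

  prefix-route : ∀ {a b bs} → a ∈ b ∷ bs → Unique (b ∷ bs) → Linked R (b ∷ bs) →
                 Route b a (_∈ b ∷ bs)
  prefix-route {a} {b} {bs} a∈b∷bs u l with ∈-∃++ a∈b∷bs
  ... | pre , post , b∷bs≡ = record
    { body      = pre
    ; starts-at = starts pre b∷bs≡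
    ; unique    = Unique-++⁻ˡ (pre ++ [ a ]) (subst Unique split u)
    ; linked    = Linked-++⁻ˡ (pre ++ [ a ]) (subst (Linked R) split l)
    ; within    = ++⁻ˡ (pre ++ [ a ]) (subst (All (_∈ b ∷ bs)) split (All.tabulate (λ y∈ → y∈)))
    }
    where
    split : b ∷ bs ≡ (pre ++ [ a ]) ++ post
    split = trans b∷bs≡ (sym (++-assoc pre [ a ] post))
    starts : ∀ pre → b ∷ bs ≡ pre ++ a ∷ post → ∃[ t ] (pre ++ [ a ] ≡ b ∷ t)
    starts []        refl = [] , refl
    starts (p ∷ pre) refl = pre ++ [ a ] , refl

  route-map : ∀ {b a} {S S′ : A → Set} → (∀ {y} → S y → S′ y) → Route b a S → Route b a S′
  route-map S⇒S′ ρ = record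
    { body = body ; starts-at = starts-at ; unique = unique ; linked = linked
    ; within = All.map S⇒S′ within }
    where open Route ρ

  route-∷ʳ : ∀ {b a′ a} {S S′ : A → Set} → Route b a′ S → R a′ a →
             (∀ {y} → S y → y ≢ a) → (∀ {y} → S y → S′ y) → S′ a → Route b a S′
  route-∷ʳ {a′ = a′} {a} ρ r S⇒≢a S⇒S′ S′a = record
    { body      = body ++ [ a′ ]
    ; starts-at = let (t , eq) = starts-at in t ++ [ a ] , cong (_++ [ a ]) eq
    ; unique    = Unique-∷ʳ unique (λ a∈ → S⇒≢a (All.lookup within a∈) refl)
    ; linked    = Linked-∷ʳ body linked r
    ; within    = ++⁺ (All.map S⇒S′ within) (S′a ∷ [])
    }
    where open Route ρ

  meeting-route : ∀ {a as b bs c} → Unique (a ∷ as) → Linked R (a ∷ as) →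
                  Unique (b ∷ bs) → Linked R (b ∷ bs) → c ∈ a ∷ as → c ∈ b ∷ bs →
                  Route b a (λ y → y ∈ a ∷ as ⊎ y ∈ b ∷ bs)
  meeting-route _ _ ub lb (here refl) c∈b∷bs = route-map inj₂ (prefix-route c∈b∷bs ub lb)
  meeting-route {a} {a′ ∷ as} {b} {bs} (a∉a′∷as ∷ ua) (r ∷ la) ub lb (there c∈) c∈b∷bs
    with a ∈? b ∷ bs
  ... | yes a∈b∷bs = route-map inj₂ (prefix-route a∈b∷bs ub lb)
  ... | no a∉b∷bs =
    route-∷ʳ (meeting-route ua la ub lb c∈ c∈b∷bs) (R-sym r)
      [ (λ y∈ y≡a → All.lookup a∉a′∷as y∈ (sym y≡a))
      , (λ y∈ y≡a → a∉b∷bs (subst (_∈ b ∷ bs) y≡a y∈)) ]′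
      [ (λ y∈ → inj₁ (there y∈)) , inj₂ ]′
      (inj₁ (here refl))

minimal : ∀ {P : ℕ → Set} → Decidable P → ∀ {k} → P k → ∃[ m ] (P m × (∀ {j} → j < m → ¬ P j))
minimal P? {zero} P0 = zero , P0 , λ ()
minimal P? {suc k} P1+k with P? zero
... | yes P0 = zero , P0 , λ ()
... | no ¬P0 =
  let (m , P1+m , below) = minimal (λ j → P? (suc j)) P1+k in
  suc m , P1+m , λ { {zero} _ → ¬P0 ; {suc j} j<m → below (s≤s⁻¹ j<m) }

module _ {n : ℕ} (G : Graph n) where

  Adj : Fin n → Fin n → Set
  Adj x y = E G x y ≡ true

  Adj-sym : ∀ {x y} → Adj x y → Adj y x
  Adj-sym {x} {y} xy = trans (E-sym G y x) xy

  Adj-irrefl : ∀ {x y} → Adj x y → x ≢ y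
  Adj-irrefl {x} xx refl with trans (sym xx) (E-irr G x)
  ... | ()

  acyclic-closing-vertex : Full G → Acyclic G → ∀ {x a b} body → Adj x a → Adj x b →
                           Unique ((b ∷ body) ++ [ a ]) → Linked Adj ((b ∷ body) ++ [ a ]) →
                           All (x ≢_) ((b ∷ body) ++ [ a ]) → ⊥
  acyclic-closing-vertex full acyclic {x} {a} {b} body xa xb u l x∉
    = false≢true (trans (sym (acyclic x (b ∷ body) a cycle (s≤s z≤n))) (Adj-sym xa))
    where
    false≢true : false ≢ true
    false≢true ()
    cycle : IsPath G (x ∷ (b ∷ body) ++ [ a ])
    cycle = (λ ()) , All.universal full _ , x∉ ∷ u , xb ∷ l

  acyclic-meeting-paths : Full G → Acyclic G → ∀ {x a b as bs c} → a ≢ b → Adj x a → Adj x b →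
                          Unique (a ∷ as) → Linked Adj (a ∷ as) →
                          Unique (b ∷ bs) → Linked Adj (b ∷ bs) →
                          c ∈ a ∷ as → c ∈ b ∷ bs → ¬ x ∈ a ∷ as → ¬ x ∈ b ∷ bs → ⊥
  acyclic-meeting-paths full acyclic {x} {a} {b} a≢b xa xb ua la ub lb c∈a∷as c∈b∷bs x∉a∷as x∉b∷bs
    with meeting-route _≟ᶠ_ Adj-sym ua la ub lb c∈a∷as c∈b∷bs
  ... | record { body = [] ; starts-at = _ , a∷[]≡b∷t } = a≢b (∷-injectiveˡ a∷[]≡b∷t)
  ... | record { body = r ∷ body ; starts-at = _ , r∷⋯≡b∷t ; unique = u ; linked = l ; within = w }
    with refl ← ∷-injectiveˡ r∷⋯≡b∷t =
    acyclic-closing-vertex full acyclic body xa xb u l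
      (All.map (λ { (inj₁ y∈) refl → x∉a∷as y∈ ; (inj₂ y∈) refl → x∉b∷bs y∈ }) w)

module Distance {n : ℕ} (G : Graph n) (connected : Connected G) (root : Fin n) where

  Within : ℕ → Fin n → Set
  Within zero    u = u ≡ root
  Within (suc k) u = Within k u ⊎ ∃[ w ] (Adj G u w × Within k w)

  within? : ∀ k → Decidable (Within k)
  within? zero    u = u ≟ᶠ root
  within? (suc k) u = within? k u ⊎-dec any? (λ w → (E G u w ≟ᵇ true) ×-dec within? k w)

  within-path : ∀ x xs → Linked (Adj G) (x ∷ xs) → last (x ∷ xs) ≡ just root → Within (length xs) x
  within-path x []       _        x≡root = just-injective x≡root
  within-path x (y ∷ xs) (xy ∷ l) ends   = inj₂ (y , xy , within-path y xs l ends)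

  reachable : ∀ u → ∃[ k ] Within k u
  reachable u with connected u root
  ... | [] , ([]≢[] , _) , _ = ⊥-elim ([]≢[] refl)
  ... | x ∷ xs , (_ , _ , _ , l) , refl , ends = length xs , within-path x xs l ends

  least-within : ∀ u → ∃[ m ] (Within m u × (∀ {j} → j < m → ¬ Within j u))
  least-within u = minimal (λ k → within? k u) (proj₂ (reachable u))

  dist : Fin n → ℕ
  dist u = proj₁ (least-within u)

  within-dist : ∀ u → Within (dist u) u
  within-dist u = proj₁ (proj₂ (least-within u))

  dist-minimal : ∀ u {j} → j < dist u → ¬ Within j u
  dist-minimal u = proj₂ (proj₂ (least-within u))

  dist-≤ : ∀ {u j} → Within j u → dist u ≤ j
  dist-≤ {u} {j} wj = ≮⇒≥ (λ j<dist → dist-minimal u j<dist wj)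

  dist-root : dist root ≡ 0
  dist-root = n≤0⇒n≡0 (dist-≤ refl)

  dist≡0⇒root : ∀ {u} → dist u ≡ 0 → u ≡ root
  dist≡0⇒root {u} eq = subst (λ k → Within k u) eq (within-dist u)

  dist-adj : ∀ {u w} → Adj G u w → dist u ≤ suc (dist w)
  dist-adj {w = w} uw = dist-≤ (inj₂ (w , uw , within-dist w))

  parent : ∀ u → u ≢ root → ∃[ p ] (Adj G u p × suc (dist p) ≡ dist u)
  parent u u≢root with dist u in eq | within-dist u
  ... | zero  | _ = ⊥-elim (u≢root (dist≡0⇒root eq))
  ... | suc k | inj₁ wk = ⊥-elim (dist-minimal u (subst (k <_) (sym eq) ≤-refl) wk)
  ... | suc k | inj₂ (p , up , wp) =
    p , up , cong suc (≤-antisym (dist-≤ wp) (s≤s⁻¹ (subst (_≤ suc (dist p)) eq (dist-adj up))))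

  record Geodesic (u : Fin n) : Set where
    field
      tail        : List (Fin n)
      closer      : All (λ y → dist y < dist u) tail
      unique      : Unique (u ∷ tail)
      linked      : Linked (Adj G) (u ∷ tail)
      ends        : ∃[ xs ] (u ∷ tail ≡ xs ++ [ root ])
      length-tail : length tail ≡ dist u

  ≢root : ∀ {u k} → dist u ≡ suc k → u ≢ root
  ≢root dist≡1+k refl with trans (sym dist-root) dist≡1+k
  ... | ()

  geodesic-at : ∀ k u → dist u ≡ k → Geodesic u
  geodesic-at zero u dist≡0 rewrite dist≡0⇒root dist≡0 = record
    { tail = [] ; closer = [] ; unique = [] ∷ [] ; linked = [-]
    ; ends = [] , refl ; length-tail = sym dist-root }
  geodesic-at (suc k) u dist≡1+k with parent u (≢root dist≡1+k)
  ... | p , up , 1+dist-p = record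
    { tail        = p ∷ tail
    ; closer      = closer′
    ; unique      = All.map (λ y-closer u≡y → <-irrefl (cong dist (sym u≡y)) y-closer) closer′ ∷ unique
    ; linked      = up ∷ linked
    ; ends        = let (xs , eq) = ends in u ∷ xs , cong (u ∷_) eq
    ; length-tail = trans (cong suc length-tail) 1+dist-p
    }
    where
    p-closer : dist p < dist u
    p-closer = ≤-reflexive 1+dist-p
    open Geodesic (geodesic-at k p (suc-injective (trans 1+dist-p dist≡1+k)))
    closer′ : All (λ y → dist y < dist u) (p ∷ tail)
    closer′ = p-closer ∷ All.map (λ y-closer → <-trans y-closer p-closer) closer

  geodesic : ∀ u → Geodesic u
  geodesic u = geodesic-at (dist u) u refl

  path-to-root : Fin n → List (Fin n)
  path-to-root u = u ∷ Geodesic.tail (geodesic u)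

  root-on-path-to-root : ∀ u → root ∈ path-to-root u
  root-on-path-to-root u =
    let (xs , eq) = Geodesic.ends (geodesic u) in
    subst (root ∈_) (sym eq) (∈-++⁺ʳ xs (here refl))

  not-on-path-to-root : ∀ {x u} → x ≢ u → dist u ≤ dist x → ¬ x ∈ path-to-root u
  not-on-path-to-root x≢u _         (here x≡u)  = x≢u x≡u
  not-on-path-to-root {u = u} _ du≤dx (there x∈) =
    <⇒≱ (All.lookup (Geodesic.closer (geodesic u)) x∈) du≤dx

  vertex-at-dist : ∀ {k} m u → dist u ≡ k + m → ∃[ w ] dist w ≡ k
  vertex-at-dist {k} zero    u eq = u , trans eq (+-identityʳ k)
  vertex-at-dist {k} (suc m) u eq =
    let eq′ = trans eq (+-suc k m)
        (p , _ , 1+dist-p) = parent u (≢root eq′) in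
    vertex-at-dist m p (suc-injective (trans 1+dist-p eq′))

  path-to-root-of-length : Full G → ∀ {m u} → 0 < m → m ≤ suc (dist u) →
    ∃[ P ] (IsPath G P × length P ≡ m × ∃[ xs ] (P ≡ xs ++ [ root ]))
  path-to-root-of-length full {suc k} {u} _ 1+k≤1+du =
    let (w , dist-w) = vertex-at-dist (dist u ∸ k) u (sym (m+[n∸m]≡n (s≤s⁻¹ 1+k≤1+du)))
        open Geodesic (geodesic w) in
    w ∷ tail , ((λ ()) , All.universal full _ , unique , linked)
             , cong suc (trans length-tail dist-w) , ends

module Spider {n : ℕ} (G : Graph n) (full : Full G) (connected : Connected G) (acyclic : Acyclic G)
              (centre : Fin n) (branch : ∀ w → 3 ≤ deg G w → w ≡ centre) where

  open Distance G connected centre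
  open import Data.List.Membership.DecPropositional (_≟ᶠ_ {n}) using (_∈?_)

  paths-to-centre-separate : ∀ {x a b} → a ≢ b → Adj G x a → Adj G x b →
                             ¬ x ∈ path-to-root a → ¬ x ∈ path-to-root b → ⊥
  paths-to-centre-separate {a = a} {b} a≢b xa xb =
    acyclic-meeting-paths G full acyclic a≢b xa xb
      (Geodesic.unique (geodesic a)) (Geodesic.linked (geodesic a))
      (Geodesic.unique (geodesic b)) (Geodesic.linked (geodesic b))
      (root-on-path-to-root a) (root-on-path-to-root b)

  adj-dist-≢ : ∀ {u w} → Adj G u w → dist u ≢ dist w
  adj-dist-≢ {u} {w} uw du≡dw with u ≟ᶠ centre
  ... | yes refl = Adj-irrefl G uw (sym (dist≡0⇒root (trans (sym du≡dw) dist-root)))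
  ... | no u≢centre =
    let (p , up , 1+dp≡du) = parent u u≢centre
        dp<du : dist p < dist u
        dp<du = ≤-reflexive 1+dp≡du in
    paths-to-centre-separate (λ p≡w → <⇒≢ dp<du (trans (cong dist p≡w) (sym du≡dw))) up uw
      (not-on-path-to-root (λ u≡p → <⇒≢ dp<du (cong dist (sym u≡p))) (<⇒≤ dp<du))
      (not-on-path-to-root (Adj-irrefl G uw) (≤-reflexive (sym du≡dw)))

  adj-dist-step : ∀ {u w} → Adj G u w → dist w ≡ suc (dist u) ⊎ dist u ≡ suc (dist w)
  adj-dist-step {u} {w} uw with <-cmp (dist u) (dist w)
  ... | tri< du<dw _ _ = inj₁ (≤-antisym (dist-adj (Adj-sym G uw)) du<dw)
  ... | tri≈ _ du≡dw _ = ⊥-elim (adj-dist-≢ uw du≡dw)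
  ... | tri> _ _ dw<du = inj₂ (≤-antisym (dist-adj uw) dw<du)

  unique-closer-neighbour : ∀ {y x z} → Adj G y x → Adj G y z →
                            dist y ≡ suc (dist x) → dist y ≡ suc (dist z) → x ≡ z
  unique-closer-neighbour {y} {x} {z} yx yz dy≡1+dx dy≡1+dz with x ≟ᶠ z
  ... | yes x≡z = x≡z
  ... | no x≢z  = ⊥-elim (paths-to-centre-separate x≢z yx yz (off dy≡1+dx) (off dy≡1+dz))
    where
    off : ∀ {a} → dist y ≡ suc (dist a) → ¬ y ∈ path-to-root a
    off dy≡1+da = not-on-path-to-root (λ y≡a → 1+n≢n (trans (sym dy≡1+da) (cong dist y≡a)))
                                      (subst (_ ≤_) (sym dy≡1+da) (n≤1+n _))

  unique-farther-neighbour : ∀ {y x z} → y ≢ centre → Adj G y x → Adj G y z →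
                             dist x ≡ suc (dist y) → dist z ≡ suc (dist y) → x ≡ z
  unique-farther-neighbour {y} {x} {z} y≢centre yx yz dx≡1+dy dz≡1+dy with x ≟ᶠ z
  ... | yes x≡z = x≡z
  ... | no x≢z  =
    let (p , yp , 1+dp≡dy) = parent y y≢centre
        ≢p : ∀ {a} → dist a ≡ suc (dist y) → a ≢ p
        ≢p da≡1+dy a≡p = <-asym (≤-reflexive 1+dp≡dy)
                           (subst (λ t → dist y < dist t) a≡p (≤-reflexive (sym da≡1+dy))) in
    ⊥-elim (y≢centre (branch y
      (length-filterᵇ-≥3 (E G y) (allFin n) x≢z (≢p dx≡1+dy) (≢p dz≡1+dy)
        (∈-allFin x) (∈-allFin z) (∈-allFin p) yx yz yp)))

  -- A turn at y would give y two closer neighbours (closing a cycle through the centre) or two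
  -- farther neighbours, which together with its parent make y a branch vertex.
  path-avoiding-centre-monotone : ∀ P → Unique P → Linked (Adj G) P → All (_≢ centre) P →
                                  Ascending dist P ⊎ Descending dist P
  path-avoiding-centre-monotone []          _ _ _ = inj₁ []
  path-avoiding-centre-monotone (x ∷ [])    _ _ _ = inj₁ [-]
  path-avoiding-centre-monotone (x ∷ y ∷ []) _ (xy ∷ _) _ with adj-dist-step xy
  ... | inj₁ up   = inj₁ (up ∷ [-])
  ... | inj₂ down = inj₂ (down ∷ [-])
  path-avoiding-centre-monotone (x ∷ y ∷ z ∷ r) ((_ ∷ x≢z ∷ _) ∷ u) (xy ∷ yz ∷ l)
                                (_ ∷ y≢centre ∷ ≢centre)
    with adj-dist-step xy | path-avoiding-centre-monotone (y ∷ z ∷ r) u (yz ∷ l) (y≢centre ∷ ≢centre)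
  ... | inj₁ up   | inj₁ ups          = inj₁ (up ∷ ups)
  ... | inj₂ down | inj₂ downs        = inj₂ (down ∷ downs)
  ... | inj₂ down | inj₁ (up′ ∷ _)    =
    ⊥-elim (x≢z (unique-farther-neighbour y≢centre (Adj-sym G xy) yz down up′))
  ... | inj₁ up   | inj₂ (down′ ∷ _)  =
    ⊥-elim (x≢z (unique-closer-neighbour (Adj-sym G xy) yz up down′))

  module _ (l : ℕ) (shallow : ∀ u → dist u < 2 ^ l) where

    coloring : Fin n → ℕ
    coloring u with u ≟ᶠ centre
    ... | yes _ = suc l
    ... | no  _ = ruler l (dist u)

    coloring-centre : coloring centre ≡ suc l
    coloring-centre with centre ≟ᶠ centre
    ... | yes _ = refl
    ... | no centre≢centre = ⊥-elim (centre≢centre refl)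

    coloring-off-centre : ∀ {u} → u ≢ centre → coloring u ≡ ruler l (dist u)
    coloring-off-centre {u} u≢centre with u ≟ᶠ centre
    ... | yes u≡centre = ⊥-elim (u≢centre u≡centre)
    ... | no  _        = refl

    dist-positive : ∀ {u} → u ≢ centre → 0 < dist u
    dist-positive {u} u≢centre = n≢0⇒n>0 (λ du≡0 → u≢centre (dist≡0⇒root du≡0))

    coloring-range : ∀ u → 1 ≤ coloring u × coloring u ≤ suc l
    coloring-range u with u ≟ᶠ centre
    ... | yes _        = s≤s z≤n , ≤-refl
    ... | no u≢centre  =
      ruler-positive l (dist-positive u≢centre) (shallow u) , m≤n⇒m≤1+n (ruler-≤ l (dist u))

    uniqueMax-through-centre : ∀ {P} → centre ∈ P → UniqueMax G coloring P
    uniqueMax-through-centre centre∈P =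
      centre , centre∈P , λ y _ y≢centre →
        subst₂ _<_ (sym (coloring-off-centre y≢centre)) (sym coloring-centre) (s≤s (ruler-≤ l (dist y)))

    uniqueMax-on-span : ∀ {P a b} → (∀ {y} → y ∈ P → y ≢ centre) → Spans dist P a b →
                        UniqueMax G coloring P
    uniqueMax-on-span ≢centre S =
      let (y , y∈ , dy≡a) = Spans.onto S ≤-refl (Spans.a≤b S)
          (z , z∈ , dz≡b) = Spans.onto S (Spans.a≤b S) ≤-refl in
      spans-uniqueMax dist (ruler l) coloring S
        (ruler-uniqueMaxOn l (subst (0 <_) dy≡a (dist-positive (≢centre y∈))) (Spans.a≤b S)
                              (subst (_< 2 ^ l) dz≡b (shallow z)))
        (λ y∈ → coloring-off-centre (≢centre y∈))

    uniqueMax-avoiding-centre : ∀ x r → Unique (x ∷ r) → Linked (Adj G) (x ∷ r) →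
                                ¬ centre ∈ x ∷ r → UniqueMax G coloring (x ∷ r)
    uniqueMax-avoiding-centre x r u l centre∉ =
      [ (λ ups   → uniqueMax-on-span ≢centre (proj₂ (ascending-spans dist x r ups)))
      , (λ downs → uniqueMax-on-span ≢centre (proj₂ (descending-spans dist x r downs)))
      ]′ (path-avoiding-centre-monotone (x ∷ r) u l (All.tabulate ≢centre))
      where
      ≢centre : ∀ {y} → y ∈ x ∷ r → y ≢ centre
      ≢centre y∈ refl = centre∉ y∈

    coloring-isUM : HasUMColoring G (suc l)
    coloring-isUM = coloring , (λ u _ → coloring-range u) , uniqueMax
      where
      uniqueMax : ∀ P → IsPath G P → UniqueMax G coloring P
      uniqueMax P _ with centre ∈? P
      uniqueMax P _                       | yes centre∈P = uniqueMax-through-centre centre∈P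
      uniqueMax [] ([]≢[] , _)            | no _         = ⊥-elim ([]≢[] refl)
      uniqueMax (x ∷ r) (_ , _ , u , l)   | no centre∉   = uniqueMax-avoiding-centre x r u l centre∉

  path-or-coloring : ∀ l → (∃[ P ] (IsPath G P × length P ≡ 2 ^ l × ∃[ xs ] (P ≡ xs ++ [ centre ])))
                           ⊎ HasUMColoring G (suc l)
  path-or-coloring l with any? (λ u → 2 ^ l ≤? suc (dist u))
  ... | yes (u , 2^l≤1+du) = inj₁ (path-to-root-of-length full (m^n>0 2 l) 2^l≤1+du)
  ... | no no-deep-vertex  =
    inj₂ (coloring-isUM l λ u →
      <-trans (n<1+n (dist u)) (≰⇒> (λ 2^l≤1+du → no-deep-vertex (u , 2^l≤1+du))))

proposition3 : (l n : ℕ) (T : Graph n) → IsTree T → UMCriticalOf (l + 2) T →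
    (v : Fin n) → 3 ≤ deg T v → (∀ w → 3 ≤ deg T w → w ≡ v) →
    ∃[ P ] (IsPath T P × length P ≡ 2 ^ l × ∃[ xs ] (P ≡ xs ++ [ v ]))
proposition3 l n T (full , connected , acyclic) (isUM , _) v _ branch =
  [ (λ path → path)
  , (λ coloring → ⊥-elim (proj₂ isUM (suc l) (≤-reflexive (sym (+-comm l 2))) coloring))
  ]′ (Spider.path-or-coloring T full connected acyclic v branch l)
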